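{- Let $n$ be a positive integer and let $x_1$ be a positive integer whose orbit $x_1, x_2 = Col(x_1), \dots, x_{n} = Col^{n-1}(x_1)$ has step sizes $m_1, m_2, \dots, m_n$ (where $m_i$ is the step size of $x_i$) with $m_n = 1$. Let $D(n) = 4 \cdot 2^{m_1 + m_2 + \cdots + m_{n-1}}$. Then for every natural number $R$, the orbit starting at $x_1' = x_1 + R\,D(n)$ shares the same orbit rhythm of length $n$ as the orbit of $x_1$; that is, for each $i \in \{1,\dots,n\}$ the step size of $Col^{i-1}(x_1')$ equals $m_i$. Consequently the orbits starting at $x_1, x_1 + D(n), x_1 + 2D(n), \dots$ form a class of orbits sharing the orbit rhythm $\langle m_1,\dots,m_n\rangle$.
   Context: The Collatz map $Col$ on the positive integers is defined as follows. If $x$ is odd, $Col(x) = (3x+1)/2^{m}$, where $m \ge 1$ is the exponent of the largest power of $2$ dividing $3x+1$; if $x$ is even, $Col(x) = x/2^{m}$, where $m \ge 1$ is the exponent of the largest power of $2$ dividing $x$. In either case this exponent $m$ is called the step size of $x$. $Col^{0}(x) = x$ and $Col^{i+1}(x) = Col(Col^{i}(x))$. Two orbits (starting at $x$ and $x'$) share the orbit rhythm of length $n$ if the step sizes of $Col^{i-1}(x)$ and $Col^{i-1}(x')$ agree for all $i = 1,\dots,n$; the sequence $\langle m_1,\dots,m_n\rangle$ of these step sizes is the orbit rhythm. -}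

module Defs where

open import Data.Nat using (ℕ; zero; suc; _+_; _*_; _^_; _%_; _/_; _≟_)
open import Data.Nat.Properties using (m^n≢0)
open import Data.Bool using (Bool; true; false; if_then_else_)
open import Data.List using (List; []; _∷_; map; upTo)
open import Data.Nat.ListAction using (sum)
open import Relation.Nullary.Decidable using (does)

ν₂-fuel : ℕ → ℕ → ℕ
ν₂-fuel zero    y = zero
ν₂-fuel (suc f) y with does (y % 2 ≟ 0)
... | true  = suc (ν₂-fuel f (y / 2))
... | false = zero

-- Exponent of the largest power of 2 dividing y (exact for y ≥ 1, since
-- y halvings always suffice). ν₂ 0 = 0 by convention (never used on 0 below).
ν₂ : ℕ → ℕ
ν₂ y = ν₂-fuel y y

isOdd : ℕ → Bool
isOdd x = does (x % 2 ≟ 1)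

pre : ℕ → ℕ
pre x = if isOdd x then 3 * x + 1 else x

stepSize : ℕ → ℕ
stepSize x = ν₂ (pre x)

Col : ℕ → ℕ
Col x = _/_ (pre x) (2 ^ stepSize x) {{m^n≢0 2 (stepSize x)}}

Col^ : ℕ → ℕ → ℕ
Col^ zero    x = x
Col^ (suc i) x = Col (Col^ i x)

-- m_{i+1} = step size of Col^i(x)  (0-based index i)
m : ℕ → ℕ → ℕ
m x i = stepSize (Col^ i x)

-- D(n) = 4 · 2^(m_1 + ⋯ + m_{n-1}) for the orbit of x (n ≥ 1);
-- m_1..m_{n-1} are m x 0, …, m x (n ∸ 2), i.e. the first (n-1) step sizes.
D : ℕ → ℕ → ℕ
D x zero    = 4
D x (suc k) = 4 * 2 ^ sum (map (m x) (upTo k))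

{-# OPTIONS --safe #-}
-- Write pre x = 2 ^ s * o with s the step size of x and o = Col x odd. For even t,
-- pre (x + t) = pre x + c * t with c = 3 or 1 according to the parity of x, so adding
-- 2 ^ (s + 1) * w to x turns pre x into 2 ^ s * (o + 2 c w): the step size is unchanged
-- and Col x moves by 2 c w. Along the orbit a shift by 2 ^ (1 + m₁ + ⋯ + m_k) therefore
-- survives k steps with the same step sizes, and when m_k = 1 this modulus is D(k).
module Submission where

open import Defs
open import Data.Nat using (ℕ; zero; suc; _+_; _*_; _^_; _%_; _/_; _≤_; _<_; _≟_; z≤n; s≤s; NonZero; >-nonZero)
open import Data.Nat.Properties
open import Data.Nat.DivMod using (m≡m%n+[m/n]*n; m%n<n; m*n%n≡0; m*n/n≡m; [m+kn]%n≡m%n; m/n<m)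
open import Data.Nat.Induction using (<-rec)
open import Data.Nat.Tactic.RingSolver using (solve-∀)
open import Data.Nat.ListAction using (sum)
open import Data.Nat.ListAction.Properties using (sum-++)
open import Relation.Nullary.Decidable using (does)
open import Function using (_∘_)
open import Algebra.Properties.CommutativeSemigroup *-commutativeSemigroup using (x∙yz≈y∙xz)
open import Data.Bool using (true; false; if_then_else_)
open import Data.List using (map; upTo; applyUpTo; _++_; [_])
open import Data.List.Properties using (map-upTo; map-applyUpTo; map-cong; map-++; upTo-∷ʳ)
open import Data.Product using (∃₂; _×_; _,_; proj₁; proj₂)
open import Data.Sum using (_⊎_; inj₁; inj₂)
open import Relation.Binary.PropositionalEquality using (_≡_; refl; sym; trans; cong; cong₂; subst; module ≡-Reasoning)

m%2≡0⊎m%2≡1 : ∀ m → m % 2 ≡ 0 ⊎ m % 2 ≡ 1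
m%2≡0⊎m%2≡1 m with m % 2 | m%n<n m 2
... | 0           | _                 = inj₁ refl
... | 1           | _                 = inj₂ refl
... | suc (suc _) | s≤s (s≤s ())

m%2≡0⇒m≡2*[m/2] : ∀ {m} → m % 2 ≡ 0 → m ≡ 2 * (m / 2)
m%2≡0⇒m≡2*[m/2] {m} m-even = begin
  m                 ≡⟨ m≡m%n+[m/n]*n m 2 ⟩
  m % 2 + m / 2 * 2 ≡⟨ cong (_+ m / 2 * 2) m-even ⟩
  m / 2 * 2         ≡⟨ *-comm (m / 2) 2 ⟩
  2 * (m / 2)       ∎
  where open ≡-Reasoning

[2*m]%2≡0 : ∀ m → (2 * m) % 2 ≡ 0
[2*m]%2≡0 m = trans (cong (_% 2) (*-comm 2 m)) (m*n%n≡0 m 2)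

[2*m]/2≡m : ∀ m → (2 * m) / 2 ≡ m
[2*m]/2≡m m = trans (cong (_/ 2) (*-comm 2 m)) (m*n/n≡m m 2)

[m+2*n]%2≡m%2 : ∀ m n → (m + 2 * n) % 2 ≡ m % 2
[m+2*n]%2≡m%2 m n = trans (cong (λ k → (m + k) % 2) (*-comm 2 n)) ([m+kn]%n≡m%n m n 2)

odd⇒>0 : ∀ {o} → o % 2 ≡ 1 → 0 < o
odd⇒>0 {suc _} _ = s≤s z≤n

n<2^n : ∀ n → n < 2 ^ n
n<2^n zero    = s≤s z≤n
n<2^n (suc n) = begin
  suc (suc n)   ≡⟨ +-comm 1 (suc n) ⟩
  suc n + 1     ≤⟨ +-mono-≤ (n<2^n n) (m^n>0 2 n) ⟩
  2 ^ n + 2 ^ n ≡⟨ cong (2 ^ n +_) (sym (+-identityʳ (2 ^ n))) ⟩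
  2 ^ suc n     ∎
  where open ≤-Reasoning

odd-factorisation : ∀ m → 0 < m → ∃₂ λ k o → o % 2 ≡ 1 × m ≡ 2 ^ k * o
odd-factorisation = <-rec _ factor
  where
  factor : ∀ m → (∀ {h} → h < m → 0 < h → ∃₂ λ k o → o % 2 ≡ 1 × h ≡ 2 ^ k * o) →
           0 < m → ∃₂ λ k o → o % 2 ≡ 1 × m ≡ 2 ^ k * o
  factor m rec m>0 with m%2≡0⊎m%2≡1 m
  ... | inj₂ m-odd = 0 , m , m-odd , sym (*-identityˡ m)
  ... | inj₁ m-even with rec h<m h>0
    where
    h : ℕ
    h = m / 2
    m≡2h : m ≡ 2 * h
    m≡2h = m%2≡0⇒m≡2*[m/2] m-even
    h<m : h < m
    h<m = m/n<m m 2 {{>-nonZero m>0}} ≤-refl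
    h>0 : 0 < h
    h>0 = n≢0⇒n>0 λ h≡0 → <⇒≢ m>0 (sym (trans m≡2h (cong (2 *_) h≡0)))
  ... | k , o , o-odd , h≡2^ko = suc k , o , o-odd , (begin
    m               ≡⟨ m%2≡0⇒m≡2*[m/2] m-even ⟩
    2 * (m / 2)     ≡⟨ cong (2 *_) h≡2^ko ⟩
    2 * (2 ^ k * o) ≡⟨ *-assoc 2 (2 ^ k) o ⟨
    2 ^ suc k * o   ∎)
    where open ≡-Reasoning

ν₂-fuel-odd : ∀ f {o} → o % 2 ≡ 1 → ν₂-fuel (suc f) o ≡ 0
ν₂-fuel-odd f o-odd rewrite o-odd = refl

ν₂-fuel-2* : ∀ f m → ν₂-fuel (suc f) (2 * m) ≡ suc (ν₂-fuel f m)
ν₂-fuel-2* f m rewrite [2*m]%2≡0 m | [2*m]/2≡m m = refl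

ν₂-fuel-2^k*o : ∀ {f k o} → k ≤ f → o % 2 ≡ 1 → ν₂-fuel f (2 ^ k * o) ≡ k
ν₂-fuel-2^k*o {zero}  {zero}      _         _     = refl
ν₂-fuel-2^k*o {suc f} {zero}  {o} _         o-odd =
  trans (cong (ν₂-fuel (suc f)) (*-identityˡ o)) (ν₂-fuel-odd f o-odd)
ν₂-fuel-2^k*o {suc f} {suc k} {o} (s≤s k≤f) o-odd = begin
  ν₂-fuel (suc f) (2 ^ suc k * o)   ≡⟨ cong (ν₂-fuel (suc f)) (*-assoc 2 (2 ^ k) o) ⟩
  ν₂-fuel (suc f) (2 * (2 ^ k * o)) ≡⟨ ν₂-fuel-2* f (2 ^ k * o) ⟩
  suc (ν₂-fuel f (2 ^ k * o))       ≡⟨ cong suc (ν₂-fuel-2^k*o k≤f o-odd) ⟩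
  suc k                             ∎
  where open ≡-Reasoning

-- The fuel 2 ^ k * o suffices because it exceeds k.
ν₂-2^k*o : ∀ k {o} → o % 2 ≡ 1 → ν₂ (2 ^ k * o) ≡ k
ν₂-2^k*o k {o} o-odd = ν₂-fuel-2^k*o k≤fuel o-odd
  where
  k≤fuel : k ≤ 2 ^ k * o
  k≤fuel = ≤-trans (<⇒≤ (n<2^n k)) (m≤m*n (2 ^ k) o {{>-nonZero (odd⇒>0 o-odd)}})

Col-characterisation : ∀ x {s o} → o % 2 ≡ 1 → pre x ≡ 2 ^ s * o → stepSize x ≡ s × Col x ≡ o
Col-characterisation x {s} {o} o-odd pre≡ = stepSize≡s , (begin
  Col x                                  ≡⟨ cong (λ e → _/_ (pre x) (2 ^ e) {{m^n≢0 2 e}}) stepSize≡s ⟩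
  _/_ (pre x) (2 ^ s) {{2^s≢0}}          ≡⟨ cong (λ n → _/_ n (2 ^ s) {{2^s≢0}}) (trans pre≡ (*-comm (2 ^ s) o)) ⟩
  _/_ (o * 2 ^ s) (2 ^ s) {{2^s≢0}}      ≡⟨ m*n/n≡m o (2 ^ s) {{2^s≢0}} ⟩
  o                                      ∎)
  where
  open ≡-Reasoning
  2^s≢0 : NonZero (2 ^ s)
  2^s≢0 = m^n≢0 2 s
  stepSize≡s : stepSize x ≡ s
  stepSize≡s = trans (cong ν₂ pre≡) (ν₂-2^k*o s o-odd)

slope : ℕ → ℕ
slope x = if isOdd x then 3 else 1

isOdd[m+2*n]≡isOdd[m] : ∀ m n → isOdd (m + 2 * n) ≡ isOdd m
isOdd[m+2*n]≡isOdd[m] m n = cong (λ r → does (r ≟ 1)) ([m+2*n]%2≡m%2 m n)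

pre[x+2*t] : ∀ x t → pre (x + 2 * t) ≡ pre x + slope x * (2 * t)
pre[x+2*t] x t rewrite isOdd[m+2*n]≡isOdd[m] x t with isOdd x
... | true  = odd-branch x t
  where
  odd-branch : ∀ x t → 3 * (x + 2 * t) + 1 ≡ 3 * x + 1 + 3 * (2 * t)
  odd-branch = solve-∀
... | false = cong (x +_) (sym (*-identityˡ (2 * t)))

pre>0 : ∀ {x} → 0 < x → 0 < pre x
pre>0 {x} x>0 with isOdd x
... | true  = m≤n+m 1 (3 * x)
... | false = x>0

Col-odd-part : ∀ {x} → 0 < x → Col x % 2 ≡ 1 × pre x ≡ 2 ^ stepSize x * Col x
Col-odd-part {x} x>0 with odd-factorisation (pre x) (pre>0 x>0)
... | k , o , o-odd , pre≡2^ko with Col-characterisation x {k} {o} o-odd pre≡2^ko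
... | stepSize≡k , Col≡o =
  subst (λ c → c % 2 ≡ 1) (sym Col≡o) o-odd ,
  trans pre≡2^ko (cong₂ (λ e c → 2 ^ e * c) (sym stepSize≡k) (sym Col≡o))

Col-shift : ∀ {x} w → 0 < x →
            stepSize (x + 2 ^ stepSize x * (2 * w)) ≡ stepSize x ×
            Col (x + 2 ^ stepSize x * (2 * w)) ≡ Col x + 2 * (slope x * w)
Col-shift {x} w x>0 = Col-characterisation (x + 2 ^ s * (2 * w)) shifted-odd pre≡
  where
  open ≡-Reasoning
  s : ℕ
  s = stepSize x
  shifted-odd : (Col x + 2 * (slope x * w)) % 2 ≡ 1
  shifted-odd = trans ([m+2*n]%2≡m%2 (Col x) (slope x * w)) (proj₁ (Col-odd-part x>0))
  rearrange : ∀ p c q w → p * q + c * (2 * (p * w)) ≡ p * (q + 2 * (c * w))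
  rearrange = solve-∀
  pre≡ : pre (x + 2 ^ s * (2 * w)) ≡ 2 ^ s * (Col x + 2 * (slope x * w))
  pre≡ = begin
    pre (x + 2 ^ s * (2 * w))                   ≡⟨ cong (λ t → pre (x + t)) (x∙yz≈y∙xz (2 ^ s) 2 w) ⟩
    pre (x + 2 * (2 ^ s * w))                   ≡⟨ pre[x+2*t] x (2 ^ s * w) ⟩
    pre x + slope x * (2 * (2 ^ s * w))         ≡⟨ cong (_+ slope x * (2 * (2 ^ s * w))) (proj₂ (Col-odd-part x>0)) ⟩
    2 ^ s * Col x + slope x * (2 * (2 ^ s * w)) ≡⟨ rearrange (2 ^ s) (slope x) (Col x) w ⟩
    2 ^ s * (Col x + 2 * (slope x * w))         ∎

Col^-suc : ∀ i x → Col^ (suc i) x ≡ Col^ i (Col x)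
Col^-suc zero    x = refl
Col^-suc (suc i) x = cong Col (Col^-suc i x)

m-suc : ∀ x i → m x (suc i) ≡ m (Col x) i
m-suc x i = cong stepSize (Col^-suc i x)

stepSum : ℕ → ℕ → ℕ
stepSum x k = sum (map (m x) (upTo k))

stepSum-suc : ∀ x k → stepSum x (suc k) ≡ stepSize x + stepSum (Col x) k
stepSum-suc x k = cong (λ ms → stepSize x + sum ms) (begin
  map (m x) (applyUpTo suc k)     ≡⟨ map-applyUpTo suc (m x) k ⟩
  applyUpTo (m x ∘ suc) k         ≡⟨ map-upTo (m x ∘ suc) k ⟨
  map (m x ∘ suc) (upTo k)        ≡⟨ map-cong (m-suc x) (upTo k) ⟩
  map (m (Col x)) (upTo k)        ∎)
  where open ≡-Reasoning

stepSum-∷ʳ : ∀ x k → stepSum x (suc k) ≡ stepSum x k + m x k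
stepSum-∷ʳ x k = begin
  sum (map (m x) (upTo (suc k)))        ≡⟨ cong (sum ∘ map (m x)) (upTo-∷ʳ k) ⟨
  sum (map (m x) (upTo k ++ [ k ]))     ≡⟨ cong sum (map-++ (m x) (upTo k) [ k ]) ⟩
  sum (map (m x) (upTo k) ++ [ m x k ]) ≡⟨ sum-++ (map (m x) (upTo k)) [ m x k ] ⟩
  stepSum x k + (m x k + 0)             ≡⟨ cong (stepSum x k +_) (+-identityʳ (m x k)) ⟩
  stepSum x k + m x k                   ∎
  where open ≡-Reasoning

period : ℕ → ℕ → ℕ
period x k = 2 ^ suc (stepSum x (suc k))

period≡2^stepSize*[2*2^stepSum] : ∀ x k → period x k ≡ 2 ^ stepSize x * (2 * 2 ^ stepSum (Col x) k)
period≡2^stepSize*[2*2^stepSum] x k = begin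
  2 * 2 ^ stepSum x (suc k)    ≡⟨ cong (λ e → 2 * 2 ^ e) (stepSum-suc x k) ⟩
  2 * 2 ^ (stepSize x + T)     ≡⟨ cong (2 *_) (^-distribˡ-+-* 2 (stepSize x) T) ⟩
  2 * (2 ^ stepSize x * 2 ^ T) ≡⟨ x∙yz≈y∙xz 2 (2 ^ stepSize x) (2 ^ T) ⟩
  2 ^ stepSize x * (2 * 2 ^ T) ∎
  where
  open ≡-Reasoning
  T : ℕ
  T = stepSum (Col x) k

Col-period-shift : ∀ k {x} u → 0 < x →
                   m (x + period x k * u) 0 ≡ m x 0 ×
                   Col (x + period x k * u) ≡ Col x + 2 ^ suc (stepSum (Col x) k) * (slope x * u)
Col-period-shift k {x} u x>0 = subst (λ y → stepSize y ≡ stepSize x) (sym x+period≡) (proj₁ shift) , (begin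
  Col (x + period x k * u)                     ≡⟨ cong Col x+period≡ ⟩
  Col (x + 2 ^ stepSize x * (2 * (2 ^ T * u))) ≡⟨ proj₂ shift ⟩
  Col x + 2 * (slope x * (2 ^ T * u))          ≡⟨ cong (Col x +_) (regroup (slope x) (2 ^ T) u) ⟩
  Col x + 2 ^ suc T * (slope x * u)            ∎)
  where
  open ≡-Reasoning
  T : ℕ
  T = stepSum (Col x) k
  shift : stepSize (x + 2 ^ stepSize x * (2 * (2 ^ T * u))) ≡ stepSize x ×
          Col (x + 2 ^ stepSize x * (2 * (2 ^ T * u))) ≡ Col x + 2 * (slope x * (2 ^ T * u))
  shift = Col-shift (2 ^ T * u) x>0
  regroup : ∀ c p u → 2 * (c * (p * u)) ≡ 2 * p * (c * u)
  regroup = solve-∀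
  reassoc : ∀ a b u → a * (2 * b) * u ≡ a * (2 * (b * u))
  reassoc = solve-∀
  x+period≡ : x + period x k * u ≡ x + 2 ^ stepSize x * (2 * (2 ^ T * u))
  x+period≡ = cong (x +_) (trans (cong (_* u) (period≡2^stepSize*[2*2^stepSum] x k)) (reassoc (2 ^ stepSize x) (2 ^ T) u))

period-shift-preserves-rhythm : ∀ k {x} u → 0 < x → ∀ {i} → i ≤ k → m (x + period x k * u) i ≡ m x i
period-shift-preserves-rhythm k       u x>0 {zero}  _         = proj₁ (Col-period-shift k u x>0)
period-shift-preserves-rhythm (suc k) {x} u x>0 {suc i} (s≤s i≤k) = begin
  m (x + period x (suc k) * u) (suc i)          ≡⟨ m-suc (x + period x (suc k) * u) i ⟩
  m (Col (x + period x (suc k) * u)) i          ≡⟨ cong (λ y → m y i) (proj₂ (Col-period-shift (suc k) u x>0)) ⟩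
  m (Col x + period (Col x) k * (slope x * u)) i ≡⟨ period-shift-preserves-rhythm k (slope x * u) Col[x]>0 i≤k ⟩
  m (Col x) i                                   ≡⟨ m-suc x i ⟨
  m x (suc i)                                   ∎
  where
  open ≡-Reasoning
  Col[x]>0 : 0 < Col x
  Col[x]>0 = odd⇒>0 (proj₁ (Col-odd-part x>0))

period≡D : ∀ x k → m x k ≡ 1 → period x k ≡ D x (suc k)
period≡D x k mₖ≡1 = begin
  2 * 2 ^ stepSum x (suc k)        ≡⟨ cong (λ e → 2 * 2 ^ e) (trans (stepSum-∷ʳ x k) (cong (stepSum x k +_) mₖ≡1)) ⟩
  2 * 2 ^ (stepSum x k + 1)        ≡⟨ cong (2 *_) (^-distribˡ-+-* 2 (stepSum x k) 1) ⟩
  2 * (2 ^ stepSum x k * (2 * 1))  ≡⟨ twice-double (2 ^ stepSum x k) ⟩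
  4 * 2 ^ stepSum x k              ∎
  where
  open ≡-Reasoning
  twice-double : ∀ p → 2 * (p * (2 * 1)) ≡ 4 * p
  twice-double = solve-∀

theorem3 : (n x₁ : ℕ) → 1 ≤ n → 1 ≤ x₁ → stepSize (Col^ (n Data.Nat.∸ 1) x₁) ≡ 1 →
    (R : ℕ) → (i : ℕ) → i < n →
      stepSize (Col^ i (x₁ + R * D x₁ n)) ≡ stepSize (Col^ i x₁)
theorem3 zero    _ () _ _ _ _ _
theorem3 (suc k) x _ x>0 mₖ≡1 R i (s≤s i≤k) = begin
  m (x + R * D x (suc k)) i ≡⟨ cong (λ d → m (x + d) i) R*D≡period*R ⟩
  m (x + period x k * R) i  ≡⟨ period-shift-preserves-rhythm k R x>0 i≤k ⟩
  m x i                     ∎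
  where
  open ≡-Reasoning
  R*D≡period*R : R * D x (suc k) ≡ period x k * R
  R*D≡period*R = trans (*-comm R (D x (suc k))) (cong (_* R) (sym (period≡D x k mₖ≡1)))
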